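{- Let $q\geq 3$ be an odd integer, $r$ the order of $2$ modulo $q$, $\varphi$ Euler's function and $\omega(q)$ the number of distinct prime factors of $q$. If $\omega(q)=1$ and $\varphi(q)/r$ is odd, then $\mathcal{E}'(q)=\emptyset$; if $\omega(q)=1$ and $\varphi(q)/r$ is even, then the set $\mathcal{E}'(q)$ of semi-bad classes is a coherent set of $r$ elements. If $\omega(q)\geq 2$, then $\mathcal{E}'(q)\neq\emptyset$ and there exists a coherent set $\mathcal{C}$ with $|\mathcal{C}|=r$.
   Context: The order $r$ of $2$ modulo $q$ is the least positive integer with $2^r\equiv1\pmod q$. The bad classes modulo $q$ are the elements of $\mathcal{E}(q)=\{1,2,\dots,2^{r-1}\}\subset(\mathbb{Z}/q\mathbb{Z})^*$. A class of $(\mathbb{Z}/q\mathbb{Z})^*$ is semi-bad if it does not belong to $\mathcal{E}(q)$ but its square does; $\mathcal{E}'(q)$ is the set of semi-bad classes. A set of semi-bad classes is called coherent if it is nonempty and the product of any two of its elements is a bad class. -}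

module Defs where

open import Data.Nat using (ℕ; zero; suc; _+_; _*_; _^_; _<_; _≤_; _%_)
open import Data.Nat.Coprimality using (Coprime; coprime?)
open import Data.Nat.Primality using (Prime; prime?)
open import Data.Nat.Divisibility using (_∣_; _∣?_)
open import Data.List using (List; length; filter; upTo; [])
open import Data.List.Membership.Propositional using (_∈_)
open import Data.List.Relation.Unary.Unique.Propositional using (Unique)
open import Data.Product using (Σ; _×_; ∃)
open import Data.Sum using (_⊎_)
open import Relation.Nullary using (¬_)
open import Relation.Nullary.Decidable using (_×-dec_)
open import Relation.Binary.PropositionalEquality using (_≡_; _≢_)

-- Euler's totient: number of a ∈ {0,…,q-1} coprime to q (agrees with φ(q) for q ≥ 2).
φ : ℕ → ℕ
φ q = length (filter (λ a → coprime? a q) (upTo q))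

ω : ℕ → ℕ
ω q = length (filter (λ p → prime? p ×-dec p ∣? q) (upTo (suc q)))

CongMod : ℕ → ℕ → ℕ → Set
CongMod q a b = ∃ λ k → (a ≡ b + k * q) ⊎ (b ≡ a + k * q)

IsOrder2 : ℕ → ℕ → Set
IsOrder2 q r = 0 < r × CongMod q (2 ^ r) (1)
             × (∀ s → 0 < s → CongMod q (2 ^ s) (1) → r ≤ s)

-- Classes of (ℤ/qℤ)* are represented by their least nonnegative residues.
Unit : ℕ → ℕ → Set
Unit q a = a < q × Coprime a q

-- Bad classes (as a predicate on residues, invariant under ≡ mod q): 𝓔(q) = {1, 2, …, 2^(r-1)} (mod q).
Bad : ℕ → ℕ → ℕ → Set
Bad q r a = ∃ λ k → k < r × CongMod q (a) (2 ^ k)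

SemiBad : ℕ → ℕ → ℕ → Set
SemiBad q r a = Unit q a × ¬ Bad q r a × Bad q r (a * a)

Coherent : ℕ → ℕ → List ℕ → Set
Coherent q r C = Unique C × C ≢ []
               × (∀ a → a ∈ C → SemiBad q r a)
               × (∀ a b → a ∈ C → b ∈ C → Bad q r (a * b))

module Submission where

-- Let T = {1, 2, …, 2^(r−1)} be the subgroup of bad classes of G = (ℤ/qℤ)*; a unit
-- a is semi-bad when a ∉ T but a² ∈ T, i.e. when a·T has order 2 in G/T.
-- (1) A semi-bad a makes H = T ∪ a·T a subgroup of order 2r; counting the cosets
--     of H (Lagrange) gives 2r ∣ φ(q), so φ(q)/r odd leaves no semi-bad class.
-- (2) Without semi-bad classes the units outside T fall into classes x·T ∪ x⁻¹·T of
--     size 2r, so φ(q)/r is odd.  Hence φ(q)/r even yields a semi-bad a, and the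
--     coset a·T is a coherent set of r semi-bad classes; for a prime power q, where
--     ±1 are the only square roots of 1, every semi-bad class lies in a·T.
-- (3) If q has two prime factors, the Chinese remainder theorem gives a square root
--     w ≠ ±1 of 1; as T contains at most one square root of 1 besides 1, w or −w is
--     semi-bad, and its coset is again coherent of size r.

open import Data.Nat
open import Data.Nat.Properties
open import Data.Nat.Divisibility
open import Data.Nat.DivMod
open import Data.Nat.Coprimality using (Coprime; coprime?; coprime-Bézout; coprime-divisor)
open import Data.Nat.Primality using (Prime; prime?; euclidsLemma; prime⇒irreducible; prime⇒nonTrivial)
open import Data.Nat.Primality.Factorisation using (factorise)
open import Data.Nat.ListAction using (product)
open import Data.Nat.Induction using (<-rec)
open import Data.List.Relation.Unary.All using (_∷_)
open import Data.List.Relation.Unary.AllPairs using (_∷_)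
open import Data.Empty using (⊥; ⊥-elim)
open import Data.Nat.GCD using (module Bézout)
open import Data.Nat.Tactic.RingSolver using (solve-∀)
open import Data.Sum using (_⊎_; inj₁; inj₂)
import Data.Sum as Sum
open import Defs
open import Data.List using (List; []; _∷_; _++_; length; filter; tabulate; upTo)
open import Data.Fin using (toℕ; fromℕ<)
open import Data.Fin.Properties using (toℕ-injective; toℕ-fromℕ<; toℕ<n)
open import Data.List.Properties using (length-filter; filter-reject; length-tabulate; length-++)
open import Data.List.Membership.Propositional using (_∈_)
open import Data.List.Membership.Propositional.Properties using (∈-filter⁺; ∈-filter⁻; ∈-tabulate⁺; ∈-tabulate⁻; ∈-++⁺ˡ; ∈-++⁺ʳ; ∈-++⁻; ∈-upTo⁺; ∈-upTo⁻)
open import Data.List.Membership.Propositional.Properties.WithK using (unique∧set⇒bag)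
open import Data.List.Relation.Binary.BagAndSetEquality using (∼bag⇒↭)
open import Data.List.Relation.Binary.Permutation.Propositional.Properties using (↭-length)
open import Data.List.Relation.Unary.Any using (here; there)
open import Data.List.Relation.Unary.Unique.Propositional using (Unique)
import Data.List.Relation.Unary.Unique.Propositional.Properties as Unique
open import Data.Product using (Σ; ∃; _×_; _,_; proj₁; proj₂)
import Data.Product as Product
open import Function.Bundles using (_⇔_; mk⇔; Equivalence)
open import Relation.Nullary using (¬_; ¬?; Dec; yes; no; contradiction)
open import Relation.Nullary.Decidable using (map′; _⊎-dec_; _×-dec_)
open import Relation.Unary using (Pred; Decidable)
open import Relation.Binary using (Rel; IsEquivalence; Setoid)
import Relation.Binary.Reasoning.Setoid as SetoidReasoning
import Relation.Binary as B
open import Relation.Binary.PropositionalEquality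
open import Level using (0ℓ)
open import Function using (_∘_)

unique-length : {xs ys : List ℕ} → Unique xs → Unique ys →
                (∀ {z} → z ∈ xs ⇔ z ∈ ys) → length xs ≡ length ys
unique-length u v same = ↭-length (∼bag⇒↭ (unique∧set⇒bag u v same))

two-distinct-members : ∀ {xs : List ℕ} → Unique xs → 2 ≤ length xs →
                       ∃ λ x → ∃ λ y → x ≢ y × x ∈ xs × y ∈ xs
two-distinct-members {x ∷ y ∷ _} ((x≢y ∷ _) ∷ _) _ = x , y , x≢y , here refl , there (here refl)
two-distinct-members {_ ∷ []} _ (s≤s ())

singleton : ∀ (xs : List ℕ) → length xs ≡ 1 → ∃ λ x → xs ≡ x ∷ []
singleton (x ∷ []) _ = x , refl
singleton (_ ∷ _ ∷ _) ()

length-split : {P : Pred ℕ 0ℓ} (P? : Decidable P) (xs : List ℕ) →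
               length xs ≡ length (filter P? xs) + length (filter (¬? ∘ P?) xs)
length-split P? [] = refl
length-split P? (x ∷ xs) with P? x
... | yes _ = cong suc (length-split P? xs)
... | no _  = trans (cong suc (length-split P? xs)) (sym (+-suc _ _))

module Classes {_∼_ : Rel ℕ 0ℓ} (isEquivalence : IsEquivalence _∼_) (_∼?_ : B.Decidable _∼_) where
  open IsEquivalence isEquivalence
    renaming (refl to ∼-refl; sym to ∼-sym; trans to ∼-trans)

  class : ℕ → List ℕ → List ℕ
  class x L = filter (x ∼?_) L

  outside : ℕ → List ℕ → List ℕ
  outside x L = filter (¬? ∘ (x ∼?_)) L

  class-outside : ∀ {x y} L → ¬ x ∼ y → ∀ {z} → z ∈ class y (outside x L) ⇔ z ∈ class y L
  class-outside {x} {y} L x≁y = mk⇔ to from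
    where
    to : ∀ {z} → z ∈ class y (outside x L) → z ∈ class y L
    to z∈ with ∈-filter⁻ (y ∼?_) {xs = outside x L} z∈
    ... | z∈out , y∼z = ∈-filter⁺ (y ∼?_) (proj₁ (∈-filter⁻ (¬? ∘ (x ∼?_)) {xs = L} z∈out)) y∼z
    from : ∀ {z} → z ∈ class y L → z ∈ class y (outside x L)
    from z∈ with ∈-filter⁻ (y ∼?_) {xs = L} z∈
    ... | z∈L , y∼z = ∈-filter⁺ (y ∼?_)
      (∈-filter⁺ (¬? ∘ (x ∼?_)) z∈L (λ x∼z → x≁y (∼-trans x∼z (∼-sym y∼z)))) y∼z

  classes-divide : ∀ n (L : List ℕ) → Unique L →
                   (∀ {x} → x ∈ L → length (class x L) ≡ n) → n ∣ length L
  classes-divide n L = go (length L) L ≤-refl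
    where
    go : ∀ k L → length L ≤ k → Unique L →
         (∀ {x} → x ∈ L → length (class x L) ≡ n) → n ∣ length L
    go _ [] _ _ _ = n ∣0
    go zero (_ ∷ _) () _ _
    go (suc k) L@(x ∷ L₀) len≤ u size =
      subst (n ∣_) (sym (length-split (x ∼?_) L))
        (∣m∣n⇒∣m+n (∣-reflexive (sym (size (here refl)))) (go k (outside x L) shorter u′ size′))
      where
      shorter : length (outside x L) ≤ k
      shorter = subst (λ l → length l ≤ k) (sym (filter-reject (¬? ∘ (x ∼?_)) (λ x≁x → x≁x ∼-refl)))
                  (≤-trans (length-filter (¬? ∘ (x ∼?_)) L₀) (≤-pred len≤))
      u′ : Unique (outside x L)
      u′ = Unique.filter⁺ (¬? ∘ (x ∼?_)) u
      size′ : ∀ {y} → y ∈ outside x L → length (class y (outside x L)) ≡ n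
      size′ {y} y∈ with ∈-filter⁻ (¬? ∘ (x ∼?_)) {xs = L} y∈
      ... | y∈L , x≁y = trans (unique-length (Unique.filter⁺ (y ∼?_) u′) (Unique.filter⁺ (y ∼?_) u)
                                (class-outside L x≁y)) (size y∈L)

prime-factor : ∀ {d} → 2 ≤ d → ∃ λ p → Prime p × p ∣ d
prime-factor {d@(suc _)} 2≤d with factorise d
... | record { factors = [] ; isFactorisation = d≡1 } = contradiction d≡1 (>⇒≢ 2≤d)
... | record { factors = p ∷ ps ; isFactorisation = d≡ ; factorsPrime = p-prime ∷ _ } =
  p , p-prime , divides (product ps) (trans d≡ (*-comm p (product ps)))

no-common-prime⇒coprime : ∀ {m n} → m ≢ 0 → (∀ {p} → Prime p → p ∣ m → p ∣ n → ⊥) → Coprime m n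
no-common-prime⇒coprime m≢0 _ {0} (0∣m , _) = contradiction (0∣⇒≡0 0∣m) m≢0
no-common-prime⇒coprime _ _ {1} _ = refl
no-common-prime⇒coprime _ no-common {suc (suc _)} (d∣m , d∣n) with prime-factor (s≤s (s≤s z≤n))
... | p , p-prime , p∣d = ⊥-elim (no-common p-prime (∣-trans p∣d d∣m) (∣-trans p∣d d∣n))

prime>1 : ∀ {p} → Prime p → 1 < p
prime>1 {p} p-prime = nonTrivial⇒n>1 p {{prime⇒nonTrivial p-prime}}

prime∣prime^k : ∀ {p p′} k → Prime p → Prime p′ → p′ ∣ p ^ k → p′ ≡ p
prime∣prime^k zero _ p′-prime p′∣1 = contradiction (∣1⇒≡1 p′∣1) (>⇒≢ (prime>1 p′-prime))
prime∣prime^k {p} (suc k) p-prime p′-prime p′∣p^[k+1] with euclidsLemma p (p ^ k) p′-prime p′∣p^[k+1]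
... | inj₂ p′∣p^k = prime∣prime^k k p-prime p′-prime p′∣p^k
... | inj₁ p′∣p with prime⇒irreducible p-prime p′∣p
...   | inj₁ p′≡1 = contradiction p′≡1 (>⇒≢ (prime>1 p′-prime))
...   | inj₂ p′≡p = p′≡p

split-off-prime : ∀ {p} → Prime p → ∀ n → 0 < n → ∃ λ k → ∃ λ B → n ≡ p ^ k * B × ¬ p ∣ B
split-off-prime {p} p-prime = <-rec _ step
  where
  step : ∀ n → (∀ {m} → m < n → 0 < m → ∃ λ k → ∃ λ B → m ≡ p ^ k * B × ¬ p ∣ B) →
         0 < n → ∃ λ k → ∃ λ B → n ≡ p ^ k * B × ¬ p ∣ B
  step n rec 0<n with p ∣? n
  ... | no p∤n = 0 , n , sym (+-identityʳ n) , p∤n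
  ... | yes (divides m refl) =
    let k , B , m≡p^kB , p∤B = rec (m<m*n m p {{>-nonZero 0<m}} (prime>1 p-prime)) 0<m
    in suc k , B , trans (cong (_* p) m≡p^kB) (rotate (p ^ k) B p) , p∤B
    where
    0<m : 0 < m
    0<m = n≢0⇒n>0 λ m≡0 → <-irrefl refl (subst (λ m → 0 < m * p) m≡0 0<n)
    rotate : ∀ x y z → x * y * z ≡ z * x * y
    rotate = solve-∀

square-* : ∀ a b → a * b * (a * b) ≡ a * a * (b * b)
square-* = solve-∀

double-injective : ∀ {i j} → i + i ≡ j + j → i ≡ j
double-injective {i} {j} i+i≡j+j =
  *-cancelˡ-≡ i j 2 (trans (cong (i +_) (+-identityʳ i)) (trans i+i≡j+j (cong (j +_) (sym (+-identityʳ j)))))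

even-or-odd : ∀ n → ∃ λ t → n ≡ t + t ⊎ n ≡ suc (t + t)
even-or-odd zero = 0 , inj₁ refl
even-or-odd (suc n) with even-or-odd n
... | t , inj₁ n≡2t   = t , inj₂ (cong suc n≡2t)
... | t , inj₂ n≡2t+1 = suc t , inj₁ (trans (cong suc n≡2t+1) (cong suc (sym (+-suc t t))))

-- Parity of the index m = φ(q)/r, read off from the two counts.
2r∣mr⇒even : ∀ {m r} .{{_ : NonZero r}} → r + r ∣ m * r → m % 2 ≡ 0
2r∣mr⇒even {m} {r} 2r∣mr =
  n∣m⇒m%n≡0 m 2 (*-cancelʳ-∣ r (subst (_∣ m * r) (cong (r +_) (sym (+-identityʳ r))) 2r∣mr))

mr≡r+2rt⇒odd : ∀ {m r t} .{{_ : NonZero r}} → m * r ≡ r + t * (r + r) → m % 2 ≡ 1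
mr≡r+2rt⇒odd {m} {r} {t} mr≡r+2rt =
  trans (cong (_% 2) (*-cancelʳ-≡ m (1 + t * 2) r (trans mr≡r+2rt (sym (expand t r))))) ([m+kn]%n≡m%n 1 t 2)
  where
  expand : ∀ t r → (1 + t * 2) * r ≡ r + t * (r + r)
  expand = solve-∀

odd-divisor∤2 : ∀ {q X} → ¬ 2 ∣ q → 2 ≤ X → X ∣ q → ¬ X ∣ 2
odd-divisor∤2 q-odd 2≤X X∣q X∣2 with ≤-antisym (∣⇒≤ X∣2) 2≤X
... | refl = q-odd X∣q

≢0∧≢1⇒≥2 : ∀ {n} → n ≢ 0 → n ≢ 1 → 2 ≤ n
≢0∧≢1⇒≥2 {0} n≢0 _ = contradiction refl n≢0
≢0∧≢1⇒≥2 {1} _ n≢1 = contradiction refl n≢1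
≢0∧≢1⇒≥2 {suc (suc _)} _ _ = s≤s (s≤s z≤n)

-- A number with two distinct prime factors p₁, p₂ is a product A·B of coprime
-- factors A, B ≥ 2: take for A the full power of p₁ dividing it.
coprime-split : ∀ {q p₁ p₂} → q ≢ 0 → p₁ ≢ p₂ → Prime p₁ → p₁ ∣ q → Prime p₂ → p₂ ∣ q →
                ∃ λ A → ∃ λ B → q ≡ A * B × Coprime A B × 2 ≤ A × 2 ≤ B
coprime-split {q} {p₁} {p₂} q≢0 p₁≢p₂ p₁-prime p₁∣q p₂-prime p₂∣q
  with split-off-prime p₁-prime q (n≢0⇒n>0 q≢0)
... | k , B , q≡p₁^kB , p₁∤B = p₁ ^ k , B , q≡p₁^kB , A⊥B , ≢0∧≢1⇒≥2 A≢0 A≢1 , ≢0∧≢1⇒≥2 B≢0 B≢1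
  where
  A≢0 : p₁ ^ k ≢ 0
  A≢0 A≡0 = q≢0 (trans q≡p₁^kB (cong (_* B) A≡0))
  A≢1 : p₁ ^ k ≢ 1
  A≢1 A≡1 = p₁∤B (subst (p₁ ∣_) (trans q≡p₁^kB (trans (cong (_* B) A≡1) (*-identityˡ B))) p₁∣q)
  B≢0 : B ≢ 0
  B≢0 B≡0 = q≢0 (trans q≡p₁^kB (trans (cong (p₁ ^ k *_) B≡0) (*-zeroʳ (p₁ ^ k))))
  p₂∣B : p₂ ∣ B
  p₂∣B with euclidsLemma (p₁ ^ k) B p₂-prime (subst (p₂ ∣_) q≡p₁^kB p₂∣q)
  ... | inj₁ p₂∣A = contradiction (sym (prime∣prime^k k p₁-prime p₂-prime p₂∣A)) p₁≢p₂
  ... | inj₂ p₂∣B = p₂∣B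
  B≢1 : B ≢ 1
  B≢1 B≡1 = >⇒≢ (prime>1 p₂-prime) (∣1⇒≡1 (subst (p₂ ∣_) B≡1 p₂∣B))
  A⊥B : Coprime (p₁ ^ k) B
  A⊥B = no-common-prime⇒coprime A≢0 λ p-prime p∣A p∣B →
          p₁∤B (subst (_∣ B) (prime∣prime^k k p₁-prime p-prime p∣A) p∣B)

module PrimeFactors (q : ℕ) where
  private
    P? : ∀ p → Dec (Prime p × p ∣ q)
    P? p = prime? p ×-dec p ∣? q

    ∈-prime-factors⁻ : ∀ {p} → p ∈ filter P? (upTo (suc q)) → Prime p × p ∣ q
    ∈-prime-factors⁻ p∈ = proj₂ (∈-filter⁻ P? {xs = upTo (suc q)} p∈)

  two-prime-factors : 2 ≤ ω q → ∃ λ p₁ → ∃ λ p₂ → p₁ ≢ p₂ × (Prime p₁ × p₁ ∣ q) × (Prime p₂ × p₂ ∣ q)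
  two-prime-factors 2≤ω with two-distinct-members (Unique.filter⁺ P? (Unique.upTo⁺ (suc q))) 2≤ω
  ... | p₁ , p₂ , p₁≢p₂ , p₁∈ , p₂∈ = p₁ , p₂ , p₁≢p₂ , ∈-prime-factors⁻ p₁∈ , ∈-prime-factors⁻ p₂∈

  unique-prime-factor : q ≢ 0 → ω q ≡ 1 →
                        ∃ λ p → (Prime p × p ∣ q) × (∀ {p′} → Prime p′ → p′ ∣ q → p′ ≡ p)
  unique-prime-factor q≢0 ω≡1 with singleton (filter P? (upTo (suc q))) ω≡1
  ... | p , factors≡[p] = p , ∈-prime-factors⁻ (subst (p ∈_) (sym factors≡[p]) (here refl)) , only-p
    where
    only-p : ∀ {p′} → Prime p′ → p′ ∣ q → p′ ≡ p
    only-p {p′} p′-prime p′∣q with subst (p′ ∈_) factors≡[p]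
      (∈-filter⁺ P? (∈-upTo⁺ (s≤s (∣⇒≤ {{≢-nonZero q≢0}} p′∣q))) (p′-prime , p′∣q))
    ... | here p′≡p = p′≡p

module Modulo (q : ℕ) (1<q : 1 < q) where

  instance
    q-nonZero : NonZero q
    q-nonZero = >-nonZero (<-trans z<s 1<q)

  infix 4 _≈_
  _≈_ : Rel ℕ 0ℓ
  a ≈ b = a % q ≡ b % q

  ≈-setoid : Setoid 0ℓ 0ℓ
  ≈-setoid = record
    { _≈_ = _≈_ ; isEquivalence = record { refl = refl ; sym = sym ; trans = trans } }

  module ≈-Reasoning = SetoidReasoning ≈-setoid

  ≈-reflexive : ∀ {a b} → a ≡ b → a ≈ b
  ≈-reflexive = cong (_% q)

  %-≈ : ∀ a → a % q ≈ a
  %-≈ a = m%n%n≡m%n a q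

  *-cong : ∀ {a b c d} → a ≈ b → c ≈ d → a * c ≈ b * d
  *-cong {a} {b} {c} {d} a≈b c≈d = begin
    (a * c) % q             ≡⟨ %-distribˡ-* a c q ⟩
    (a % q * (c % q)) % q   ≡⟨ cong₂ (λ x y → (x * y) % q) a≈b c≈d ⟩
    (b % q * (d % q)) % q   ≡⟨ %-distribˡ-* b d q ⟨
    (b * d) % q             ∎
    where open ≡-Reasoning

  *-congˡ : ∀ c {a b} → a ≈ b → c * a ≈ c * b
  *-congˡ c = *-cong {c} {c} refl

  *-congʳ : ∀ c {a b} → a ≈ b → a * c ≈ b * c
  *-congʳ c a≈b = *-cong a≈b (refl {x = c % q})

  +-congʳ : ∀ c {a b} → a ≈ b → a + c ≈ b + c
  +-congʳ c {a} {b} a≈b = begin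
    (a + c) % q             ≡⟨ %-distribˡ-+ a c q ⟩
    (a % q + c % q) % q     ≡⟨ cong (λ x → (x + c % q) % q) a≈b ⟩
    (b % q + c % q) % q     ≡⟨ %-distribˡ-+ b c q ⟨
    (b + c) % q             ∎
    where open ≡-Reasoning

  private
    excess : ∀ {a b} → a ≈ b → b / q ≤ a / q → a ≡ b + (a / q ∸ b / q) * q
    excess {a} {b} a≈b le = begin
      a                                     ≡⟨ m≡m%n+[m/n]*n a q ⟩
      a % q + a / q * q                     ≡⟨ cong₂ (λ x y → x + y * q) a≈b (sym (m+[n∸m]≡n le)) ⟩
      b % q + (b / q + d) * q               ≡⟨ cong (b % q +_) (*-distribʳ-+ q (b / q) d) ⟩
      b % q + (b / q * q + d * q)           ≡⟨ +-assoc (b % q) _ _ ⟨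
      b % q + b / q * q + d * q             ≡⟨ cong (_+ d * q) (m≡m%n+[m/n]*n b q) ⟨
      b + d * q                             ∎
      where
      open ≡-Reasoning
      d = a / q ∸ b / q

  ≈⇒CongMod : ∀ {a b} → a ≈ b → CongMod q a b
  ≈⇒CongMod {a} {b} a≈b with ≤-total (b / q) (a / q)
  ... | inj₁ le = (a / q ∸ b / q) , inj₁ (excess a≈b le)
  ... | inj₂ le = (b / q ∸ a / q) , inj₂ (excess (sym a≈b) le)

  CongMod⇒≈ : ∀ {a b} → CongMod q a b → a ≈ b
  CongMod⇒≈ {a} {b} (k , inj₁ refl) = [m+kn]%n≡m%n b k q
  CongMod⇒≈ {a} {b} (k , inj₂ refl) = sym ([m+kn]%n≡m%n a k q)

  +-≈-cancel : ∀ a c → a + c ≈ a → q ∣ c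
  +-≈-cancel a c a+c≈a with ≈⇒CongMod a+c≈a
  ... | k , inj₁ eq = divides k (+-cancelˡ-≡ a c (k * q) eq)
  ... | k , inj₂ eq = subst (q ∣_) (sym c≡0) (q ∣0)
    where
    c≡0 : c ≡ 0
    c≡0 = m+n≡0⇒m≡0 c (sym (+-cancelˡ-≡ a 0 (c + k * q)
            (trans (+-identityʳ a) (trans eq (+-assoc a c (k * q))))))

  ∣⇒≈0 : ∀ {c} → q ∣ c → c ≈ 0
  ∣⇒≈0 (divides k refl) = trans (m*n%n≡0 k q) (sym (m*n%n≡0 0 q))

  ≈0⇒∣ : ∀ {c} → c ≈ 0 → q ∣ c
  ≈0⇒∣ {c} = +-≈-cancel 0 c

  neg1 : ℕ
  neg1 = pred q

  private
    suc-neg1 : suc neg1 ≡ q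
    suc-neg1 = suc-pred q

  ∣+1⇒≈neg1 : ∀ {x} → q ∣ x + 1 → x ≈ neg1
  ∣+1⇒≈neg1 {x} (divides zero eq) = contradiction (trans (+-comm 1 x) eq) λ ()
  ∣+1⇒≈neg1 {x} (divides (suc k) eq) = trans (cong (_% q) x≡) ([m+kn]%n≡m%n neg1 k q)
    where
    x≡ : x ≡ neg1 + k * q
    x≡ = suc-injective (begin
      suc x             ≡⟨ +-comm 1 x ⟩
      x + 1             ≡⟨ eq ⟩
      q + k * q         ≡⟨ cong (_+ k * q) suc-neg1 ⟨
      suc (neg1 + k * q) ∎)
      where open ≡-Reasoning

  ≈neg1⇒∣+1 : ∀ {x} → x ≈ neg1 → q ∣ x + 1
  ≈neg1⇒∣+1 {x} x≈neg1 = ≈0⇒∣ (begin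
    x + 1       ≈⟨ +-congʳ 1 x≈neg1 ⟩
    neg1 + 1    ≡⟨ trans (+-comm neg1 1) suc-neg1 ⟩
    q           ≈⟨ ∣⇒≈0 ∣-refl ⟩
    0           ∎)
    where open ≈-Reasoning

  neg1*neg1≈1 : neg1 * neg1 ≈ 1
  neg1*neg1≈1 = begin
    neg1 * neg1             ≈⟨ [m+kn]%n≡m%n (neg1 * neg1) 1 q ⟨
    neg1 * neg1 + 1 * q     ≡⟨ subst (λ n → neg1 * neg1 + 1 * n ≡ 1 + neg1 * n) suc-neg1 (expand neg1) ⟩
    1 + neg1 * q            ≈⟨ [m+kn]%n≡m%n 1 neg1 q ⟩
    1                       ∎
    where
    open ≈-Reasoning
    expand : ∀ p → p * p + 1 * suc p ≡ 1 + p * suc p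
    expand = solve-∀

  record Invertible (x : ℕ) : Set where
    constructor has-inverse
    field
      inverse     : ℕ
      inverse-law : x * inverse ≈ 1

  invertible-resp : ∀ {a b} → a ≈ b → Invertible a → Invertible b
  invertible-resp a≈b (has-inverse a′ aa′≈1) = has-inverse a′ (trans (*-congʳ a′ (sym a≈b)) aa′≈1)

  invertible-* : ∀ {a b} → Invertible a → Invertible b → Invertible (a * b)
  invertible-* {a} {b} (has-inverse a′ aa′≈1) (has-inverse b′ bb′≈1) = has-inverse (b′ * a′) (begin
    a * b * (b′ * a′)     ≡⟨ regroup a b b′ a′ ⟩
    a * (b * b′) * a′     ≈⟨ *-congʳ a′ (*-congˡ a bb′≈1) ⟩
    a * 1 * a′            ≡⟨ cong (_* a′) (*-identityʳ a) ⟩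
    a * a′                ≈⟨ aa′≈1 ⟩
    1                     ∎)
    where
    open ≈-Reasoning
    regroup : ∀ a b c d → a * b * (c * d) ≡ a * (b * c) * d
    regroup = solve-∀

  cancelˡ : ∀ {c a b} → Invertible c → c * a ≈ c * b → a ≈ b
  cancelˡ {c} {a} {b} (has-inverse c′ cc′≈1) ca≈cb = begin
    a               ≡⟨ *-identityˡ a ⟨
    1 * a           ≈⟨ *-congʳ a c′c≈1 ⟨
    c′ * c * a      ≡⟨ *-assoc c′ c a ⟩
    c′ * (c * a)    ≈⟨ *-congˡ c′ ca≈cb ⟩
    c′ * (c * b)    ≡⟨ *-assoc c′ c b ⟨
    c′ * c * b      ≈⟨ *-congʳ b c′c≈1 ⟩
    1 * b           ≡⟨ *-identityˡ b ⟩
    b               ∎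
    where
    open ≈-Reasoning
    c′c≈1 : c′ * c ≈ 1
    c′c≈1 = trans (≈-reflexive (*-comm c′ c)) cc′≈1

  invertible⇒coprime : ∀ {x} → Invertible x → Coprime x q
  invertible⇒coprime {x} (has-inverse y xy≈1) {d} (d∣x , d∣q) with ≈⇒CongMod xy≈1
  ... | k , inj₁ eq = ∣1⇒≡1 (∣m+n∣m⇒∣n (subst (d ∣_) (trans eq (+-comm 1 (k * q))) (∣m⇒∣m*n y d∣x))
                                        (∣n⇒∣m*n k d∣q))
  ... | k , inj₂ eq = ∣1⇒≡1 (subst (d ∣_) (sym eq) (∣m∣n⇒∣m+n (∣m⇒∣m*n y d∣x) (∣n⇒∣m*n k d∣q)))

  coprime⇒invertible : ∀ {x} → Coprime x q → Invertible x
  coprime⇒invertible {x} x⊥q with coprime-Bézout x⊥q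
  ... | Bézout.+- a b eq = has-inverse a (CongMod⇒≈ (b , inj₁ (trans (*-comm x a) (sym eq))))
  ... | Bézout.-+ a b eq = has-inverse (a * neg1) (begin
    x * (a * neg1)   ≡⟨ *-assoc x a neg1 ⟨
    x * a * neg1     ≈⟨ *-congʳ neg1 (∣+1⇒≈neg1 (divides b xa+1≡bq)) ⟩
    neg1 * neg1      ≈⟨ neg1*neg1≈1 ⟩
    1                ∎)
    where
    open ≈-Reasoning
    xa+1≡bq : x * a + 1 ≡ b * q
    xa+1≡bq = trans (+-comm (x * a) 1) (trans (cong (1 +_) (*-comm x a)) eq)

  1≉neg1 : 3 ≤ q → ¬ 1 ≈ neg1
  1≉neg1 3≤q 1≈neg1 = contradiction (∣⇒≤ (≈neg1⇒∣+1 1≈neg1)) (<⇒≱ 3≤q)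

  -- If q = A·B with A ∤ 2 and B ∤ 2, and 1 + v = u with A ∣ u and B ∣ v, then
  -- w = 1 + 2v is a square root of 1 (as q ∣ 4uv) other than 1 (as A ∤ 2v)
  -- and −1 (as B ∤ 2u).
  private
    root-from-Bézout : ∀ {A B u v} → q ≡ A * B → ¬ A ∣ 2 → ¬ B ∣ 2 → 1 + v ≡ u → A ∣ u → B ∣ v →
                       ∃ λ w → w * w ≈ 1 × ¬ w ≈ 1 × ¬ w ≈ neg1
    root-from-Bézout {A} {B} {u} {v} q≡AB A∤2 B∤2 1+v≡u A∣u B∣v = 1 + 2 * v , square≈1 , w≉1 , w≉neg1
      where
      square : ∀ v → (1 + 2 * v) * (1 + 2 * v) ≡ 1 + 4 * (v * (1 + v))
      square = solve-∀
      twice : ∀ v → 2 * (1 + v) ≡ 2 * v + 2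
      twice = solve-∀
      successor : ∀ v → 1 + 2 * v + 1 ≡ 2 * v + 2
      successor = solve-∀
      q∣vu : q ∣ v * u
      q∣vu = subst (_∣ v * u) (trans (*-comm B A) (sym q≡AB)) (*-pres-∣ B∣v A∣u)
      square≈1 : (1 + 2 * v) * (1 + 2 * v) ≈ 1
      square≈1 = trans (≈-reflexive (trans (square v) (cong (λ x → 1 + 4 * (v * x)) 1+v≡u)))
                       (%-remove-+ʳ 1 (∣n⇒∣m*n 4 q∣vu))
      w≉1 : ¬ 1 + 2 * v ≈ 1
      w≉1 w≈1 = A∤2 (∣m+n∣m⇒∣n A∣2v+2 (∣-trans (divides B (trans q≡AB (*-comm A B))) (+-≈-cancel 1 (2 * v) w≈1)))
        where
        A∣2v+2 : A ∣ 2 * v + 2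
        A∣2v+2 = subst (A ∣_) (trans (cong (2 *_) (sym 1+v≡u)) (twice v)) (∣n⇒∣m*n 2 A∣u)
      w≉neg1 : ¬ 1 + 2 * v ≈ neg1
      w≉neg1 w≈neg1 = B∤2 (∣m+n∣m⇒∣n (subst (B ∣_) (successor v) B∣w+1) (∣n⇒∣m*n 2 B∣v))
        where
        B∣w+1 : B ∣ 1 + 2 * v + 1
        B∣w+1 = ∣-trans (divides A q≡AB) (≈neg1⇒∣+1 w≈neg1)

  nontrivial-root : ∀ {A B} → ¬ 2 ∣ q → q ≡ A * B → Coprime A B → 2 ≤ A → 2 ≤ B →
                    ∃ λ w → w * w ≈ 1 × ¬ w ≈ 1 × ¬ w ≈ neg1
  nontrivial-root {A} {B} q-odd q≡AB A⊥B 2≤A 2≤B = from-Bézout (coprime-Bézout A⊥B)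
    where
    A∤2 = odd-divisor∤2 q-odd 2≤A (divides B (trans q≡AB (*-comm A B)))
    B∤2 = odd-divisor∤2 q-odd 2≤B (divides A q≡AB)
    from-Bézout : Bézout.Identity 1 A B → ∃ λ w → w * w ≈ 1 × ¬ w ≈ 1 × ¬ w ≈ neg1
    from-Bézout (Bézout.+- x y 1+yB≡xA) =
      root-from-Bézout q≡AB A∤2 B∤2 1+yB≡xA (n∣m*n x) (n∣m*n y)
    from-Bézout (Bézout.-+ x y 1+xA≡yB) =
      root-from-Bézout (trans q≡AB (*-comm A B)) B∤2 A∤2 1+xA≡yB (n∣m*n y) (n∣m*n x)

  -- Modulo a power of an odd prime p, the only square roots of 1 are ±1: if
  -- q ∣ (y − 1)(y + 1), then q is coprime to one factor, as p cannot divide both.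
  sqrt1-prime-power : ∀ {p} → Prime p → p ∣ q → (∀ {p′} → Prime p′ → p′ ∣ q → p′ ≡ p) → ¬ 2 ∣ q →
                      ∀ {x} → x * x ≈ 1 → x ≈ 1 ⊎ x ≈ neg1
  sqrt1-prime-power {p} p-prime p∣q only-p q-odd {x} x²≈1 =
    Sum.map (trans (sym (%-≈ x))) (trans (sym (%-≈ x))) (roots (x % q) (trans (*-cong (%-≈ x) (%-≈ x)) x²≈1))
    where
    p∤2 : ¬ p ∣ 2
    p∤2 = odd-divisor∤2 q-odd (prime>1 p-prime) p∣q
    coprime-to-q : ∀ {n} → ¬ p ∣ n → Coprime q n
    coprime-to-q p∤n = no-common-prime⇒coprime {q} (>⇒≢ (<-trans z<s 1<q))
      λ p′-prime p′∣q p′∣n → p∤n (subst (_∣ _) (only-p p′-prime p′∣q) p′∣n)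
    square : ∀ z → suc z * suc z ≡ 1 + z * (suc z + 1)
    square = solve-∀
    plus-two : ∀ z → z + 2 ≡ suc z + 1
    plus-two = solve-∀
    roots : ∀ y → y * y ≈ 1 → y ≈ 1 ⊎ y ≈ neg1
    roots zero 0≈1 = contradiction (trans (sym (m*n%n≡0 0 q)) (trans 0≈1 (m<n⇒m%n≡m 1<q))) λ ()
    roots (suc z) y²≈1 with p ∣? z
    ... | yes p∣z = inj₁ (%-remove-+ʳ 1 (coprime-divisor (coprime-to-q p∤z+2) (subst (q ∣_) (*-comm z _) q∣product)))
      where
      p∤z+2 : ¬ p ∣ suc z + 1
      p∤z+2 p∣z+2 = p∤2 (∣m+n∣m⇒∣n (subst (p ∣_) (sym (plus-two z)) p∣z+2) p∣z)
      q∣product : q ∣ z * (suc z + 1)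
      q∣product = +-≈-cancel 1 _ (trans (≈-reflexive (sym (square z))) y²≈1)
    ... | no p∤z = inj₂ (∣+1⇒≈neg1 (coprime-divisor (coprime-to-q p∤z) q∣product))
      where
      q∣product : q ∣ z * (suc z + 1)
      q∣product = +-≈-cancel 1 _ (trans (≈-reflexive (sym (square z))) y²≈1)

-- The powers of 2 modulo q, where 2 has order r.  They form the subgroup
-- T = {1, 2, …, 2^(r−1)} of bad classes, and a ~ b says that a and b lie in
-- the same coset of T.
module PowersOfTwo (q r : ℕ) (1<q : 1 < q) (ord : IsOrder2 q r) where
  open Modulo q 1<q public

  0<r : 0 < r
  0<r = proj₁ ord

  instance
    r-nonZero : NonZero r
    r-nonZero = >-nonZero 0<r

  2^r≈1 : 2 ^ r ≈ 1
  2^r≈1 = CongMod⇒≈ (proj₁ (proj₂ ord))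

  r-minimal : ∀ s → 0 < s → 2 ^ s ≈ 1 → r ≤ s
  r-minimal s 0<s 2^s≈1 = proj₂ (proj₂ ord) s 0<s (≈⇒CongMod 2^s≈1)

  2^-+ : ∀ m n → 2 ^ (m + n) ≡ 2 ^ m * 2 ^ n
  2^-+ = ^-distribˡ-+-* 2

  2^[kr]≈1 : ∀ k → 2 ^ (k * r) ≈ 1
  2^[kr]≈1 zero    = refl
  2^[kr]≈1 (suc k) = trans (≈-reflexive (2^-+ r (k * r))) (*-cong 2^r≈1 (2^[kr]≈1 k))

  2^-mod : ∀ n → 2 ^ n ≈ 2 ^ (n % r)
  2^-mod n = begin
    2 ^ n                             ≡⟨ cong (2 ^_) (m≡m%n+[m/n]*n n r) ⟩
    2 ^ (n % r + n / r * r)           ≡⟨ 2^-+ (n % r) (n / r * r) ⟩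
    2 ^ (n % r) * 2 ^ (n / r * r)     ≈⟨ *-congˡ (2 ^ (n % r)) (2^[kr]≈1 (n / r)) ⟩
    2 ^ (n % r) * 1                   ≡⟨ *-identityʳ _ ⟩
    2 ^ (n % r)                       ∎
    where open ≈-Reasoning

  2^-inverse : ∀ k → 2 ^ k * 2 ^ ((r ∸ 1) * k) ≈ 1
  2^-inverse k = trans (≈-reflexive (trans (sym (2^-+ k _)) (cong (2 ^_) k+[r-1]k≡kr))) (2^[kr]≈1 k)
    where
    k+[r-1]k≡kr : k + (r ∸ 1) * k ≡ k * r
    k+[r-1]k≡kr = trans (cong (_* k) (m+[n∸m]≡n 0<r)) (*-comm r k)

  2^-invertible : ∀ k → Invertible (2 ^ k)
  2^-invertible k = has-inverse (2 ^ ((r ∸ 1) * k)) (2^-inverse k)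

  -- If 2^i ≈ 2^j with i ≤ j < r then i = j, since 2^(j−i) ≈ 1 and r is minimal.
  private
    gap : ∀ {i j} → j < r → 2 ^ i ≈ 2 ^ j → i ≤ j → j ≡ i
    gap {i} {j} j<r 2^i≈2^j i≤j with m≤n⇒∃[o]m+o≡n i≤j
    ... | zero  , refl = +-identityʳ i
    ... | suc d , refl = contradiction j<r (≤⇒≯ (≤-trans (r-minimal (suc d) z<s 2^d≈1) (m≤n+m (suc d) i)))
      where
      2^d≈1 : 2 ^ suc d ≈ 1
      2^d≈1 = sym (cancelˡ (2^-invertible i)
                (trans (≈-reflexive (*-identityʳ (2 ^ i))) (trans 2^i≈2^j (≈-reflexive (2^-+ i (suc d))))))

  2^-injective : ∀ {i j} → i < r → j < r → 2 ^ i ≈ 2 ^ j → i ≡ j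
  2^-injective {i} {j} i<r j<r 2^i≈2^j with ≤-total i j
  ... | inj₁ i≤j = sym (gap j<r 2^i≈2^j i≤j)
  ... | inj₂ j≤i = gap i<r (sym 2^i≈2^j) j≤i

  infix 4 _~_
  record _~_ (a b : ℕ) : Set where
    constructor by
    field
      exponent : ℕ
      shifted  : a ≈ b * 2 ^ exponent

  ≈⇒~ : ∀ {a b} → a ≈ b → a ~ b
  ≈⇒~ {a} {b} a≈b = by 0 (trans a≈b (≈-reflexive (sym (*-identityʳ b))))

  ~-refl : ∀ {a} → a ~ a
  ~-refl = ≈⇒~ refl

  ~-sym : ∀ {a b} → a ~ b → b ~ a
  ~-sym {a} {b} (by k a≈b2^k) = by ((r ∸ 1) * k) (begin
    b                                 ≡⟨ *-identityʳ b ⟨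
    b * 1                             ≈⟨ *-congˡ b (2^-inverse k) ⟨
    b * (2 ^ k * 2 ^ ((r ∸ 1) * k))   ≡⟨ *-assoc b _ _ ⟨
    b * 2 ^ k * 2 ^ ((r ∸ 1) * k)     ≈⟨ *-congʳ _ a≈b2^k ⟨
    a * 2 ^ ((r ∸ 1) * k)             ∎)
    where open ≈-Reasoning

  ~-trans : ∀ {a b c} → a ~ b → b ~ c → a ~ c
  ~-trans {a} {b} {c} (by k a≈b2^k) (by l b≈c2^l) = by (l + k) (begin
    a                   ≈⟨ a≈b2^k ⟩
    b * 2 ^ k           ≈⟨ *-congʳ (2 ^ k) b≈c2^l ⟩
    c * 2 ^ l * 2 ^ k   ≡⟨ *-assoc c _ _ ⟩
    c * (2 ^ l * 2 ^ k) ≡⟨ cong (c *_) (2^-+ l k) ⟨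
    c * 2 ^ (l + k)     ∎)
    where open ≈-Reasoning

  x·1~x : ∀ {x} → x * 1 ~ x
  x·1~x {x} = ≈⇒~ (≈-reflexive (*-identityʳ x))

  1·x~x : ∀ {x} → 1 * x ~ x
  1·x~x {x} = ≈⇒~ (≈-reflexive (*-identityˡ x))

  ~-*-cong : ∀ {a b c d} → a ~ b → c ~ d → a * c ~ b * d
  ~-*-cong {a} {b} {c} {d} (by k a≈b2^k) (by l c≈d2^l) = by (k + l) (begin
    a * c                     ≈⟨ *-cong a≈b2^k c≈d2^l ⟩
    b * 2 ^ k * (d * 2 ^ l)   ≡⟨ interchange b (2 ^ k) d (2 ^ l) ⟩
    b * d * (2 ^ k * 2 ^ l)   ≡⟨ cong (b * d *_) (2^-+ k l) ⟨
    b * d * 2 ^ (k + l)       ∎)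
    where
    open ≈-Reasoning
    interchange : ∀ w x y z → w * x * (y * z) ≡ w * y * (x * z)
    interchange = solve-∀

  ~-cancelˡ : ∀ {a b c} → Invertible c → c * a ~ c * b → a ~ b
  ~-cancelˡ {a} {b} {c} c-inv (by k ca≈cb2^k) =
    by k (cancelˡ c-inv (trans ca≈cb2^k (≈-reflexive (*-assoc c b (2 ^ k)))))

  ~-invertible : ∀ {a b} → a ~ b → Invertible b → Invertible a
  ~-invertible {a} {b} (by k a≈b2^k) b-inv =
    invertible-resp (sym a≈b2^k) (invertible-* {b} {2 ^ k} b-inv (2^-invertible k))

  -- A coset relation is always witnessed by an exponent below r; hence it is decidable.
  ~-bounded : ∀ {a b} → a ~ b → ∃ λ k → k < r × a ≈ b * 2 ^ k
  ~-bounded {a} {b} (by k a≈b2^k) = k % r , m%n<n k r , trans a≈b2^k (*-congˡ b (2^-mod k))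

  _~?_ : B.Decidable _~_
  a ~? b = map′ (λ (k , _ , e) → by k e) ~-bounded
                (anyUpTo? (λ k → a % q ≟ (b * 2 ^ k) % q) r)

  Bad⇒~1 : ∀ {a} → Bad q r a → a ~ 1
  Bad⇒~1 (k , _ , a≡2^k) = by k (trans (CongMod⇒≈ a≡2^k) (≈-reflexive (sym (*-identityˡ (2 ^ k)))))

  ~1⇒Bad : ∀ {a} → a ~ 1 → Bad q r a
  ~1⇒Bad a~1 with ~-bounded a~1
  ... | k , k<r , a≈2^k = k , k<r , ≈⇒CongMod (trans a≈2^k (≈-reflexive (*-identityˡ (2 ^ k))))

  coset : ℕ → List ℕ
  coset b = tabulate {n = r} (λ k → b * 2 ^ toℕ k % q)

  coset-length : ∀ b → length (coset b) ≡ r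
  coset-length b = length-tabulate _

  ∈-coset⁻ : ∀ b {z} → z ∈ coset b → z < q × z ~ b
  ∈-coset⁻ b z∈ with ∈-tabulate⁻ z∈
  ... | k , refl = m%n<n _ q , by (toℕ k) (%-≈ _)

  ∈-coset⁺ : ∀ b {z} → z < q → z ~ b → z ∈ coset b
  ∈-coset⁺ b {z} z<q z~b with ~-bounded z~b
  ... | k , k<r , z≈b2^k = subst (_∈ coset b) normal-form (∈-tabulate⁺ (fromℕ< k<r))
    where
    normal-form : b * 2 ^ toℕ (fromℕ< k<r) % q ≡ z
    normal-form = trans (cong (λ i → b * 2 ^ i % q) (toℕ-fromℕ< k<r))
                        (trans (sym z≈b2^k) (m<n⇒m%n≡m z<q))

  coset-unique : ∀ {b} → Invertible b → Unique (coset b)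
  coset-unique b-inv = Unique.tabulate⁺ λ {i} {j} bi≈bj →
    toℕ-injective (2^-injective (toℕ<n i) (toℕ<n j) (cancelˡ b-inv bi≈bj))

  -- The class of a is semi-bad: a is a unit outside T whose square lies in T.
  -- (Defs.SemiBad additionally asks for the least representative, a < q.)
  SemiBadClass : ℕ → Set
  SemiBadClass a = Invertible a × ¬ a ~ 1 × a * a ~ 1

  SemiBad⇒SemiBadClass : ∀ {a} → SemiBad q r a → SemiBadClass a
  SemiBad⇒SemiBadClass ((_ , a⊥q) , ¬bad , bad²) =
    coprime⇒invertible a⊥q , (λ a~1 → ¬bad (~1⇒Bad a~1)) , Bad⇒~1 bad²

  SemiBadClass⇒SemiBad : ∀ {a} → a < q → SemiBadClass a → SemiBad q r a
  SemiBadClass⇒SemiBad a<q (a-inv , a≁1 , a²~1) =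
    (a<q , invertible⇒coprime a-inv) , (λ bad → a≁1 (Bad⇒~1 bad)) , ~1⇒Bad a²~1

  semibad-~ : ∀ {a z} → SemiBadClass a → z ~ a → SemiBadClass z
  semibad-~ (a-inv , a≁1 , a²~1) z~a =
    ~-invertible z~a a-inv , (λ z~1 → a≁1 (~-trans (~-sym z~a) z~1)) , ~-trans (~-*-cong z~a z~a) a²~1

  coset-coherent : ∀ {a} → SemiBadClass a → Coherent q r (coset a)
  coset-coherent {a} a-semibad@(a-inv , _ , a²~1) =
    coset-unique a-inv , nonempty , members-semibad , products-bad
    where
    nonempty : coset a ≢ []
    nonempty empty = <⇒≢ 0<r (sym (trans (sym (coset-length a)) (cong length empty)))
    members-semibad : ∀ z → z ∈ coset a → SemiBad q r z
    members-semibad z z∈ with ∈-coset⁻ a z∈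
    ... | z<q , z~a = SemiBadClass⇒SemiBad z<q (semibad-~ a-semibad z~a)
    products-bad : ∀ z w → z ∈ coset a → w ∈ coset a → Bad q r (z * w)
    products-bad z w z∈ w∈ =
      ~1⇒Bad (~-trans (~-*-cong (proj₂ (∈-coset⁻ a z∈)) (proj₂ (∈-coset⁻ a w∈))) a²~1)

  -- An element 2^i of order 2 in T (0 < i < r) has i + i = r: r divides i + i < 2r.
  order-two-exponent : ∀ {i} → 0 < i → i < r → 2 ^ (i + i) ≈ 1 → i + i ≡ r
  order-two-exponent {i} 0<i i<r 2^2i≈1 = from-quotient (_∣_.quotient r∣2i) (_∣_.equality r∣2i)
    where
    r∣2i : r ∣ i + i
    r∣2i = m%n≡0⇒n∣m (i + i) r (2^-injective (m%n<n (i + i) r) 0<r (trans (sym (2^-mod (i + i))) 2^2i≈1))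
    from-quotient : ∀ c → i + i ≡ c * r → i + i ≡ r
    from-quotient zero i+i≡0 = contradiction (m+n≡0⇒m≡0 i i+i≡0) (>⇒≢ 0<i)
    from-quotient 1 i+i≡r = trans i+i≡r (*-identityˡ r)
    from-quotient (suc (suc c)) i+i≡[2+c]r =
      contradiction i+i≡[2+c]r (<⇒≢ (<-≤-trans (+-mono-< i<r i<r) (+-monoʳ-≤ r (m≤m+n r (c * r)))))

  involution-exponent : ∀ {x} → x ~ 1 → x * x ≈ 1 → ¬ x ≈ 1 → ∃ λ i → x ≈ 2 ^ i × i + i ≡ r
  involution-exponent {x} x~1 x²≈1 x≉1 with ~-bounded x~1
  ... | zero , _ , x≈1 = contradiction x≈1 x≉1
  ... | i@(suc _) , i<r , x≈1·2^i = i , x≈2^i , order-two-exponent z<s i<r (begin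
    2 ^ (i + i)       ≡⟨ 2^-+ i i ⟩
    2 ^ i * 2 ^ i     ≈⟨ *-cong x≈2^i x≈2^i ⟨
    x * x             ≈⟨ x²≈1 ⟩
    1                 ∎)
    where
    open ≈-Reasoning
    x≈2^i : x ≈ 2 ^ i
    x≈2^i = trans x≈1·2^i (≈-reflexive (*-identityˡ (2 ^ i)))

  T-involution-unique : ∀ {x y} → x ~ 1 → y ~ 1 → x * x ≈ 1 → y * y ≈ 1 → ¬ x ≈ 1 → ¬ y ≈ 1 → x ≈ y
  T-involution-unique x~1 y~1 x²≈1 y²≈1 x≉1 y≉1
    with involution-exponent x~1 x²≈1 x≉1 | involution-exponent y~1 y²≈1 y≉1
  ... | i , x≈2^i , i+i≡r | j , y≈2^j , j+j≡r =
    trans x≈2^i (trans (cong (λ k → 2 ^ k % q) (double-injective {i} {j} (trans i+i≡r (sym j+j≡r)))) (sym y≈2^j))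

  involution-semibad : ∀ {x} → x * x ≈ 1 → ¬ x ~ 1 → SemiBadClass x
  involution-semibad x²≈1 x≁1 = has-inverse _ x²≈1 , x≁1 , ≈⇒~ x²≈1

  private
    negate-root : ∀ {w} → w * w ≈ 1 → neg1 * w * (neg1 * w) ≈ 1
    negate-root {w} w²≈1 = begin
      neg1 * w * (neg1 * w)     ≡⟨ square-* neg1 w ⟩
      neg1 * neg1 * (w * w)     ≈⟨ *-cong neg1*neg1≈1 w²≈1 ⟩
      1                         ∎
      where open ≈-Reasoning
    negate-≉1 : ∀ {w} → ¬ w ≈ neg1 → ¬ neg1 * w ≈ 1
    negate-≉1 {w} w≉neg1 -w≈1 = w≉neg1 (begin
      w                         ≡⟨ *-identityˡ w ⟨
      1 * w                     ≈⟨ *-congʳ w neg1*neg1≈1 ⟨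
      neg1 * neg1 * w           ≡⟨ *-assoc neg1 neg1 w ⟩
      neg1 * (neg1 * w)         ≈⟨ *-congˡ neg1 -w≈1 ⟩
      neg1 * 1                  ≡⟨ *-identityʳ neg1 ⟩
      neg1                      ∎)
      where open ≈-Reasoning
    self-negative : ∀ {w} → w * w ≈ 1 → w ≈ neg1 * w → 1 ≈ neg1
    self-negative {w} w²≈1 w≈-w = begin
      1                         ≈⟨ w²≈1 ⟨
      w * w                     ≈⟨ *-congʳ w w≈-w ⟩
      neg1 * w * w              ≡⟨ *-assoc neg1 w w ⟩
      neg1 * (w * w)            ≈⟨ *-congˡ neg1 w²≈1 ⟩
      neg1 * 1                  ≡⟨ *-identityʳ neg1 ⟩
      neg1                      ∎
      where open ≈-Reasoning

  -- If 1 has a square root w ≠ ±1 (and q ≥ 3), then w or −w is a semi-bad class: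
  -- T cannot contain both, as it has at most one square root of 1 besides 1.
  semibad-involution : 3 ≤ q → ∀ {w} → w * w ≈ 1 → ¬ w ≈ 1 → ¬ w ≈ neg1 → ∃ λ a → SemiBadClass a
  semibad-involution 3≤q {w} w²≈1 w≉1 w≉neg1 with w ~? 1 | (neg1 * w) ~? 1
  ... | no w≁1 | _        = w , involution-semibad w²≈1 w≁1
  ... | yes _  | no -w≁1  = neg1 * w , involution-semibad (negate-root w²≈1) -w≁1
  ... | yes w~1 | yes -w~1 = contradiction
    (self-negative w²≈1 (T-involution-unique w~1 -w~1 w²≈1 (negate-root w²≈1) w≉1 (negate-≉1 w≉neg1)))
    (1≉neg1 3≤q)

  semibad-representative : ∀ {a} → SemiBadClass a → SemiBad q r (a % q)
  semibad-representative {a} a-semibad = SemiBadClass⇒SemiBad (m%n<n a q) (semibad-~ a-semibad (≈⇒~ (%-≈ a)))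

  semibad? : ∀ a → Dec (SemiBad q r a)
  semibad? a = ((a <? q) ×-dec coprime? a q) ×-dec (¬? (bad? a) ×-dec bad? (a * a))
    where
    bad? : ∀ x → Dec (Bad q r x)
    bad? x = map′ ~1⇒Bad Bad⇒~1 (x ~? 1)

module UnitCounting (q r : ℕ) (1<q : 1 < q) (ord : IsOrder2 q r) where
  open PowersOfTwo q r 1<q ord public
  open Equivalence using (to; from)

  two-cosets-unique : ∀ {x y} → Invertible x → Invertible y → ¬ x ~ y →
                      Unique (coset x ++ coset y)
  two-cosets-unique {x} {y} x-inv y-inv x≁y =
    Unique.++⁺ (coset-unique x-inv) (coset-unique y-inv) λ {z} (z∈x , z∈y) →
      x≁y (~-trans (~-sym (proj₂ (∈-coset⁻ x z∈x))) (proj₂ (∈-coset⁻ y z∈y)))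

  class-of-two-cosets : ∀ {R : Rel ℕ 0ℓ} (R? : B.Decidable R) {L : List ℕ} → Unique L →
    ∀ {x y} → Invertible x → Invertible y → ¬ x ~ y →
    (∀ {z} → (z ∈ L × R x z) ⇔ (z < q × (z ~ x ⊎ z ~ y))) →
    length (filter (R? x) L) ≡ r + r
  class-of-two-cosets R? {L} L-unique {x} {y} x-inv y-inv x≁y members = begin
    length (filter (R? x) L)             ≡⟨ unique-length (Unique.filter⁺ (R? x) L-unique)
                                              (two-cosets-unique x-inv y-inv x≁y) same-members ⟩
    length (coset x ++ coset y)          ≡⟨ length-++ (coset x) ⟩
    length (coset x) + length (coset y)  ≡⟨ cong₂ _+_ (coset-length x) (coset-length y) ⟩
    r + r                                ∎
    where
    open ≡-Reasoning
    into : ∀ {z} → z < q × (z ~ x ⊎ z ~ y) → z ∈ coset x ++ coset y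
    into (z<q , inj₁ z~x) = ∈-++⁺ˡ (∈-coset⁺ x z<q z~x)
    into (z<q , inj₂ z~y) = ∈-++⁺ʳ (coset x) (∈-coset⁺ y z<q z~y)
    out-of : ∀ {z} → z ∈ coset x ++ coset y → z < q × (z ~ x ⊎ z ~ y)
    out-of z∈ with ∈-++⁻ (coset x) z∈
    ... | inj₁ z∈x = Product.map₂ inj₁ (∈-coset⁻ x z∈x)
    ... | inj₂ z∈y = Product.map₂ inj₂ (∈-coset⁻ y z∈y)
    same-members : ∀ {z} → z ∈ filter (R? x) L ⇔ z ∈ coset x ++ coset y
    same-members = mk⇔ (λ z∈ → into (to members (∈-filter⁻ (R? x) {xs = L} z∈)))
                       (λ z∈ → Product.uncurry (∈-filter⁺ (R? x)) (from members (out-of z∈)))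

  units : List ℕ
  units = filter (λ a → coprime? a q) (upTo q)

  units-unique : Unique units
  units-unique = Unique.filter⁺ (λ a → coprime? a q) (Unique.upTo⁺ q)

  ∈-units : ∀ {z} → z ∈ units ⇔ (z < q × Invertible z)
  ∈-units = mk⇔
    (λ z∈ → Product.map ∈-upTo⁻ coprime⇒invertible (∈-filter⁻ (λ a → coprime? a q) {xs = upTo q} z∈))
    (λ (z<q , z-inv) → ∈-filter⁺ (λ a → coprime? a q) (∈-upTo⁺ z<q) (invertible⇒coprime z-inv))

  -- If a² ∈ T then H = T ∪ a·T is a subgroup of order 2r;  x ∼ₕ z says z ∈ x·H.
  module CosetsOfH {a : ℕ} (a²~1 : a * a ~ 1) where
    infix 4 _∼ₕ_
    _∼ₕ_ : Rel ℕ 0ℓ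
    x ∼ₕ z = z ~ x ⊎ z ~ x * a

    private
      xaa~x : ∀ {x} → x * a * a ~ x
      xaa~x {x} = ~-trans (≈⇒~ (≈-reflexive (*-assoc x a a))) (~-trans (~-*-cong (~-refl {x}) a²~1) x·1~x)

    ∼ₕ-isEquivalence : IsEquivalence _∼ₕ_
    ∼ₕ-isEquivalence = record { refl = inj₁ ~-refl ; sym = sym′ ; trans = trans′ }
      where
      sym′ : ∀ {x z} → x ∼ₕ z → z ∼ₕ x
      sym′ (inj₁ z~x)  = inj₁ (~-sym z~x)
      sym′ (inj₂ z~xa) = inj₂ (~-sym (~-trans (~-*-cong z~xa ~-refl) xaa~x))
      trans′ : ∀ {x y z} → x ∼ₕ y → y ∼ₕ z → x ∼ₕ z
      trans′ (inj₁ y~x)  (inj₁ z~y)  = inj₁ (~-trans z~y y~x)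
      trans′ (inj₁ y~x)  (inj₂ z~ya) = inj₂ (~-trans z~ya (~-*-cong y~x ~-refl))
      trans′ (inj₂ y~xa) (inj₁ z~y)  = inj₂ (~-trans z~y y~xa)
      trans′ (inj₂ y~xa) (inj₂ z~ya) = inj₁ (~-trans z~ya (~-trans (~-*-cong y~xa ~-refl) xaa~x))

    _∼ₕ?_ : B.Decidable _∼ₕ_
    x ∼ₕ? z = (z ~? x) ⊎-dec (z ~? (x * a))

  -- Lagrange's theorem for H: a semi-bad class forces 2r ∣ φ(q).
  semibad⇒2r∣φ : ∀ {a} → SemiBadClass a → r + r ∣ φ q
  semibad⇒2r∣φ {a} (a-inv , a≁1 , a²~1) = classes-divide (r + r) units units-unique class-size
    where
    open CosetsOfH {a} a²~1
    open Classes ∼ₕ-isEquivalence _∼ₕ?_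
    class-size : ∀ {x} → x ∈ units → length (class x units) ≡ r + r
    class-size {x} x∈ =
      class-of-two-cosets _∼ₕ?_ units-unique x-inv xa-inv x≁xa (mk⇔ (Product.map₁ (proj₁ ∘ to ∈-units)) members)
      where
      x-inv = proj₂ (to ∈-units x∈)
      xa-inv = invertible-* x-inv a-inv
      x≁xa : ¬ x ~ x * a
      x≁xa x~xa = a≁1 (~-sym (~-cancelˡ x-inv (~-trans x·1~x x~xa)))
      members : ∀ {z} → z < q × (z ~ x ⊎ z ~ x * a) → z ∈ units × x ∼ₕ z
      members (z<q , inj₁ z~x)  = from ∈-units (z<q , ~-invertible z~x x-inv) , inj₁ z~x
      members (z<q , inj₂ z~xa) = from ∈-units (z<q , ~-invertible z~xa xa-inv) , inj₂ z~xa

  -- x ∼ᵢ z says z ∈ x·T ∪ x⁻¹·T: the orbits of T-translation together with inversion.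
  infix 4 _∼ᵢ_
  _∼ᵢ_ : Rel ℕ 0ℓ
  x ∼ᵢ z = z ~ x ⊎ z * x ~ 1

  ∼ᵢ-isEquivalence : IsEquivalence _∼ᵢ_
  ∼ᵢ-isEquivalence = record { refl = inj₁ ~-refl ; sym = sym′ ; trans = trans′ }
    where
    sym′ : ∀ {x z} → x ∼ᵢ z → z ∼ᵢ x
    sym′ (inj₁ z~x)  = inj₁ (~-sym z~x)
    sym′ {x} {z} (inj₂ zx~1) = inj₂ (~-trans (≈⇒~ (≈-reflexive (*-comm x z))) zx~1)
    trans′ : ∀ {x y z} → x ∼ᵢ y → y ∼ᵢ z → x ∼ᵢ z
    trans′ (inj₁ y~x)  (inj₁ z~y)  = inj₁ (~-trans z~y y~x)
    trans′ {z = z} (inj₁ y~x) (inj₂ zy~1) = inj₂ (~-trans (~-*-cong (~-refl {z}) (~-sym y~x)) zy~1)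
    trans′ {x = x} (inj₂ yx~1) (inj₁ z~y) = inj₂ (~-trans (~-*-cong z~y (~-refl {x})) yx~1)
    trans′ {x} {y} {z} (inj₂ yx~1) (inj₂ zy~1) = inj₁ z~x
      where
      -- z ~ z·(y·x) = (z·y)·x ~ x
      z~x : z ~ x
      z~x = ~-trans (~-sym (~-trans (~-*-cong (~-refl {z}) yx~1) x·1~x))
                  (~-trans (≈⇒~ (≈-reflexive (sym (*-assoc z y x))))
                    (~-trans (~-*-cong zy~1 (~-refl {x})) 1·x~x))

  _∼ᵢ?_ : B.Decidable _∼ᵢ_
  x ∼ᵢ? z = (z ~? x) ⊎-dec ((z * x) ~? 1)

  bad-units-length : length (filter (_~? 1) units) ≡ r
  bad-units-length = trans (unique-length (Unique.filter⁺ (_~? 1) units-unique) (coset-unique one-inv)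
                             same-members) (coset-length 1)
    where
    one-inv : Invertible 1
    one-inv = has-inverse 1 refl
    same-members : ∀ {z} → z ∈ filter (_~? 1) units ⇔ z ∈ coset 1
    same-members = mk⇔
      (λ z∈ → let (z∈units , z~1) = ∈-filter⁻ (_~? 1) {xs = units} z∈
               in ∈-coset⁺ 1 (proj₁ (to ∈-units z∈units)) z~1)
      (λ z∈ → let (z<q , z~1) = ∈-coset⁻ 1 z∈
               in ∈-filter⁺ (_~? 1) (from ∈-units (z<q , ~-invertible z~1 one-inv)) z~1)

  nonbad-units : List ℕ
  nonbad-units = filter (¬? ∘ (_~? 1)) units

  nonbad-unique : Unique nonbad-units
  nonbad-unique = Unique.filter⁺ (¬? ∘ (_~? 1)) units-unique

  ∈-nonbad : ∀ {z} → z ∈ nonbad-units ⇔ (z < q × Invertible z × ¬ z ~ 1)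
  ∈-nonbad = mk⇔
    (λ z∈ → let (z∈units , z≁1) = ∈-filter⁻ (¬? ∘ (_~? 1)) {xs = units} z∈
             in Product.map₂ (_, z≁1) (to ∈-units z∈units))
    (λ (z<q , z-inv , z≁1) → ∈-filter⁺ (¬? ∘ (_~? 1)) (from ∈-units (z<q , z-inv)) z≁1)

  -- Without semi-bad classes, the class of a unit x ∉ T is x·T ∪ x⁻¹·T, of size 2r:
  -- the two cosets differ, for x ~ x⁻¹ would put x² in T.
  inversion-class-size : (∀ {a} → ¬ SemiBadClass a) → ∀ {x x′} → x * x′ ≈ 1 → ¬ x ~ 1 →
                         length (filter (x ∼ᵢ?_) nonbad-units) ≡ r + r
  inversion-class-size no-semibad {x} {x′} xx′≈1 x≁1 =
    class-of-two-cosets _∼ᵢ?_ nonbad-unique x-inv x′-inv x≁x′ (mk⇔ members⁻ members⁺)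
    where
    x-inv : Invertible x
    x-inv = has-inverse x′ xx′≈1
    x′-inv : Invertible x′
    x′-inv = has-inverse x (trans (≈-reflexive (*-comm x′ x)) xx′≈1)
    x≁x′ : ¬ x ~ x′
    x≁x′ x~x′ = no-semibad (x-inv , x≁1 , ~-trans (~-*-cong (~-refl {x}) x~x′) (≈⇒~ xx′≈1))
    zx~1⇒z~x′ : ∀ {z} → z * x ~ 1 → z ~ x′
    zx~1⇒z~x′ {z} zx~1 = ~-trans (~-sym (~-trans (≈⇒~ (≈-reflexive (*-assoc z x x′)))
                                    (~-trans (~-*-cong (~-refl {z}) (≈⇒~ xx′≈1)) x·1~x)))
                           (~-trans (~-*-cong zx~1 (~-refl {x′})) 1·x~x)
    z~x′⇒zx~1 : ∀ {z} → z ~ x′ → z * x ~ 1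
    z~x′⇒zx~1 z~x′ = ~-trans (~-*-cong z~x′ (~-refl {x})) (≈⇒~ (trans (≈-reflexive (*-comm x′ x)) xx′≈1))
    x′≁1 : ¬ x′ ~ 1
    x′≁1 x′~1 = x≁1 (~-trans (~-sym x·1~x) (~-trans (~-*-cong (~-refl {x}) (~-sym x′~1)) (≈⇒~ xx′≈1)))
    members⁻ : ∀ {z} → z ∈ nonbad-units × x ∼ᵢ z → z < q × (z ~ x ⊎ z ~ x′)
    members⁻ (z∈ , inj₁ z~x)  = proj₁ (to ∈-nonbad z∈) , inj₁ z~x
    members⁻ (z∈ , inj₂ zx~1) = proj₁ (to ∈-nonbad z∈) , inj₂ (zx~1⇒z~x′ zx~1)
    members⁺ : ∀ {z} → z < q × (z ~ x ⊎ z ~ x′) → z ∈ nonbad-units × x ∼ᵢ z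
    members⁺ (z<q , inj₁ z~x) =
      from ∈-nonbad (z<q , ~-invertible z~x x-inv , λ z~1 → x≁1 (~-trans (~-sym z~x) z~1)) , inj₁ z~x
    members⁺ (z<q , inj₂ z~x′) =
      from ∈-nonbad (z<q , ~-invertible z~x′ x′-inv , λ z~1 → x′≁1 (~-trans (~-sym z~x′) z~1)) ,
      inj₂ (z~x′⇒zx~1 z~x′)

  nonbad-2r∣ : (∀ {a} → ¬ SemiBadClass a) → r + r ∣ length nonbad-units
  nonbad-2r∣ no-semibad =
    Classes.classes-divide ∼ᵢ-isEquivalence _∼ᵢ?_ (r + r) nonbad-units nonbad-unique class-size
    where
    class-size : ∀ {x} → x ∈ nonbad-units → length (filter (x ∼ᵢ?_) nonbad-units) ≡ r + r
    class-size x∈ with to ∈-nonbad x∈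
    ... | _ , has-inverse _ xx′≈1 , x≁1 = inversion-class-size no-semibad xx′≈1 x≁1

  no-semibad⇒φ : (∀ {a} → ¬ SemiBadClass a) → ∃ λ t → φ q ≡ r + t * (r + r)
  no-semibad⇒φ no-semibad =
    _∣_.quotient 2r∣nonbad , trans (length-split (_~? 1) units) (cong₂ _+_ bad-units-length (_∣_.equality 2r∣nonbad))
    where
    2r∣nonbad = nonbad-2r∣ no-semibad

module PrimePowerModulus (q r : ℕ) (1<q : 1 < q) (ord : IsOrder2 q r) (q-odd : ¬ 2 ∣ q)
                         {p : ℕ} (p-prime : Prime p) (p∣q : p ∣ q)
                         (only-p : ∀ {p′} → Prime p′ → p′ ∣ q → p′ ≡ p) where
  open PowersOfTwo q r 1<q ord

  sqrt1 : ∀ x → x * x ≈ 1 → x ≈ 1 ⊎ x ≈ neg1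
  sqrt1 x = sqrt1-prime-power p-prime p∣q only-p q-odd {x}

  -- x² ≈ y² for a unit y forces x ≈ ±y, as (x·y⁻¹)² ≈ 1.
  square-root : ∀ {x y} → Invertible y → x * x ≈ y * y → x ≈ y ⊎ x ≈ neg1 * y
  square-root {x} {y} (has-inverse y′ yy′≈1) x²≈y² =
    Sum.map (λ xy′≈1 → trans (x≈xy′y) (trans (*-congʳ y xy′≈1) (≈-reflexive (*-identityˡ y))))
            (λ xy′≈neg1 → trans (x≈xy′y) (*-congʳ y xy′≈neg1))
            (sqrt1 (x * y′) [xy′]²≈1)
    where
    open ≈-Reasoning
    [xy′]²≈1 : x * y′ * (x * y′) ≈ 1
    [xy′]²≈1 = begin
      x * y′ * (x * y′)       ≡⟨ square-* x y′ ⟩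
      x * x * (y′ * y′)       ≈⟨ *-congʳ (y′ * y′) x²≈y² ⟩
      y * y * (y′ * y′)       ≡⟨ square-* y y′ ⟨
      y * y′ * (y * y′)       ≈⟨ *-cong yy′≈1 yy′≈1 ⟩
      1                       ∎
    x≈xy′y : x ≈ x * y′ * y
    x≈xy′y = begin
      x                       ≡⟨ *-identityʳ x ⟨
      x * 1                   ≈⟨ *-congˡ x (trans (≈-reflexive (*-comm y′ y)) yy′≈1) ⟨
      x * (y′ * y)            ≡⟨ *-assoc x y′ y ⟨
      x * y′ * y              ∎

  root-of-even-power : ∀ {x} t → x * x ≈ 2 ^ (t + t) → x ~ 1 ⊎ x ~ neg1
  root-of-even-power {x} t x²≈2^2t =
    Sum.map (λ x≈2^t → by t (trans x≈2^t (≈-reflexive (sym (*-identityˡ (2 ^ t))))))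
            (by t)
            (square-root (2^-invertible t) (trans x²≈2^2t (≈-reflexive (2^-+ t t))))

  -- If r = 2u is even, −1 = 2^u lies in T.
  even-order⇒neg1~1 : ∀ u → r ≡ u + u → neg1 ~ 1
  even-order⇒neg1~1 u r≡2u with sqrt1 (2 ^ u) [2^u]²≈1
    where
    [2^u]²≈1 : 2 ^ u * 2 ^ u ≈ 1
    [2^u]²≈1 = trans (≈-reflexive (trans (sym (2^-+ u u)) (cong (2 ^_) (sym r≡2u)))) 2^r≈1
  ... | inj₂ 2^u≈neg1 = by u (trans (sym 2^u≈neg1) (≈-reflexive (sym (*-identityˡ (2 ^ u)))))
  ... | inj₁ 2^u≈1 = contradiction (r-minimal u 0<u 2^u≈1) (<⇒≱ u<r)
    where
    0<u : 0 < u
    0<u = n≢0⇒n>0 λ u≡0 → >⇒≢ 0<r (trans r≡2u (cong (λ v → v + v) u≡0))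
    u<r : u < r
    u<r = subst (u <_) (sym r≡2u) (m<m+n u 0<u)

  private
    in-T-or-neg-T : ∀ {x} → ¬ x ~ 1 → x ~ 1 ⊎ x ~ neg1 → x ~ neg1
    in-T-or-neg-T x≁1 = Sum.[ (λ x~1 → contradiction x~1 x≁1) , (λ x~neg1 → x~neg1) ]

  -- If r = 2u, a semi-bad class squares to an odd power of 2: a root of an even
  -- power would lie in T ∪ −T = T.
  even-order-square : ∀ u {x} → r ≡ u + u → SemiBadClass x → ∃ λ s → x * x ≈ 2 ^ suc (s + s)
  even-order-square u {x} r≡2u (_ , x≁1 , by i x²≈1·2^i) with even-or-odd i
  ... | s , inj₂ refl = s , trans x²≈1·2^i (≈-reflexive (*-identityˡ (2 ^ i)))
  ... | t , inj₁ refl = contradiction (~-trans x~neg1 (even-order⇒neg1~1 u r≡2u)) x≁1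
    where
    x~neg1 = in-T-or-neg-T x≁1 (root-of-even-power t (trans x²≈1·2^i (≈-reflexive (*-identityˡ (2 ^ i)))))

  -- If r = 2u + 1, every semi-bad class lies in −T: its square 2^i ≈ 2^(i + r) is
  -- an even power of 2.
  odd-order⇒in-neg-T : ∀ u {x} → r ≡ suc (u + u) → SemiBadClass x → x ~ neg1
  odd-order⇒in-neg-T u {x} r≡2u+1 (_ , x≁1 , by i x²≈1·2^i) with even-or-odd i
  ... | t , inj₁ refl = in-T-or-neg-T x≁1 (root-of-even-power t x²≈2^i)
    where
    x²≈2^i = trans x²≈1·2^i (≈-reflexive (*-identityˡ (2 ^ i)))
  ... | t , inj₂ refl = in-T-or-neg-T x≁1 (root-of-even-power (suc (t + u)) (begin
    x * x                               ≈⟨ x²≈1·2^i ⟩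
    1 * 2 ^ i                           ≡⟨ *-identityˡ (2 ^ i) ⟩
    2 ^ i                               ≡⟨ *-identityʳ (2 ^ i) ⟨
    2 ^ i * 1                           ≈⟨ *-congˡ (2 ^ i) 2^r≈1 ⟨
    2 ^ i * 2 ^ r                       ≡⟨ 2^-+ i r ⟨
    2 ^ (i + r)                         ≡⟨ cong (λ n → 2 ^ (i + n)) r≡2u+1 ⟩
    2 ^ (suc (t + t) + suc (u + u))     ≡⟨ cong (2 ^_) (regroup t u) ⟩
    2 ^ (suc (t + u) + suc (t + u))     ∎))
    where
    open ≈-Reasoning
    regroup : ∀ t u → suc (t + t) + suc (u + u) ≡ suc (t + u) + suc (t + u)
    regroup = solve-∀

  semibad-product : ∀ {a b} → SemiBadClass a → SemiBadClass b → a * b ~ 1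
  semibad-product {a} {b} a-semibad b-semibad with even-or-odd r
  ... | u , inj₂ r≡2u+1 = ~-trans (~-*-cong (odd-order⇒in-neg-T u r≡2u+1 a-semibad)
                                            (odd-order⇒in-neg-T u r≡2u+1 b-semibad)) (≈⇒~ neg1*neg1≈1)
  ... | u , inj₁ r≡2u with even-order-square u r≡2u a-semibad | even-order-square u r≡2u b-semibad
  ...   | s , a²≈2^[2s+1] | s′ , b²≈2^[2s′+1] =
    Sum.[ (λ ab~1 → ab~1) , (λ ab~neg1 → ~-trans ab~neg1 (even-order⇒neg1~1 u r≡2u)) ]
      (root-of-even-power (suc (s + s′)) (begin
        a * b * (a * b)                        ≡⟨ square-* a b ⟩
        a * a * (b * b)                        ≈⟨ *-cong a²≈2^[2s+1] b²≈2^[2s′+1] ⟩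
        2 ^ suc (s + s) * 2 ^ suc (s′ + s′)    ≡⟨ 2^-+ (suc (s + s)) (suc (s′ + s′)) ⟨
        2 ^ (suc (s + s) + suc (s′ + s′))      ≡⟨ cong (2 ^_) (regroup s s′) ⟩
        2 ^ (suc (s + s′) + suc (s + s′))      ∎))
    where
    open ≈-Reasoning
    regroup : ∀ s s′ → suc (s + s) + suc (s′ + s′) ≡ suc (s + s′) + suc (s + s′)
    regroup = solve-∀

  -- Hence all semi-bad classes lie in one coset of T: b ~ b·a² = (a·b)·a ~ a.
  semibad-same-coset : ∀ {a b} → SemiBadClass a → SemiBadClass b → b ~ a
  semibad-same-coset {a} {b} a-semibad@(_ , _ , a²~1) b-semibad =
    ~-trans (~-sym (~-trans (~-*-cong (~-refl {b}) a²~1) x·1~x))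
      (~-trans (≈⇒~ (≈-reflexive (rotate b a)))
        (~-trans (~-*-cong (semibad-product a-semibad b-semibad) (~-refl {a})) 1·x~x))
    where
    rotate : ∀ b a → b * (a * a) ≡ a * b * a
    rotate = solve-∀

module Lemma3 (q r : ℕ) (3≤q : 3 ≤ q) (q%2≡1 : q % 2 ≡ 1) (ord : IsOrder2 q r) where
  1<q : 1 < q
  1<q = ≤-trans (s≤s (s≤s z≤n)) 3≤q

  open UnitCounting q r 1<q ord

  q-odd : ¬ 2 ∣ q
  q-odd 2∣q = 0≢1+n (trans (sym (n∣m⇒m%n≡0 q 2 2∣q)) q%2≡1)

  q≢0 : q ≢ 0
  q≢0 = >⇒≢ (<-trans z<s 1<q)

  -- A semi-bad class makes φ(q)/r even (this needs no hypothesis on ω(q)).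
  odd-index⇒no-semibad : ∀ m → φ q ≡ m * r → m % 2 ≡ 1 → ∀ a → ¬ SemiBad q r a
  odd-index⇒no-semibad m φ≡mr m-odd a a-semibad = 0≢1+n (trans (sym m-even) m-odd)
    where
    m-even : m % 2 ≡ 0
    m-even = 2r∣mr⇒even {m} {r} (subst (r + r ∣_) φ≡mr (semibad⇒2r∣φ (SemiBad⇒SemiBadClass a-semibad)))

  -- If φ(q)/r is even, some class is semi-bad; otherwise φ(q) = r + 2rt.
  even-index⇒semibad : ∀ m → φ q ≡ m * r → m % 2 ≡ 0 → ∃ λ a → SemiBadClass a
  even-index⇒semibad m φ≡mr m-even with anyUpTo? semibad? q
  ... | yes (a , _ , a-semibad) = a , SemiBad⇒SemiBadClass a-semibad
  ... | no ∄semibad =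
    contradiction (trans (sym m-even) (mr≡r+2rt⇒odd {m} {r} {t} (trans (sym φ≡mr) φ≡r+2rt))) 0≢1+n
    where
    no-semibad : ∀ {a} → ¬ SemiBadClass a
    no-semibad {a} a-semibad = ∄semibad (a % q , m%n<n a q , semibad-representative a-semibad)
    t = proj₁ (no-semibad⇒φ no-semibad)
    φ≡r+2rt = proj₂ (no-semibad⇒φ no-semibad)

  prime-power-even : ω q ≡ 1 → ∀ m → φ q ≡ m * r → m % 2 ≡ 0 →
    Σ (List ℕ) λ E → ((a : ℕ) → (a ∈ E ⇔ SemiBad q r a)) × Coherent q r E × length E ≡ r
  prime-power-even ω≡1 m φ≡mr m-even with PrimeFactors.unique-prime-factor q q≢0 ω≡1
  ... | p , (p-prime , p∣q) , only-p = coset a , members , coset-coherent a-semibad , coset-length a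
    where
    open PrimePowerModulus q r 1<q ord q-odd p-prime p∣q only-p
    a-semibad = proj₂ (even-index⇒semibad m φ≡mr m-even)
    a = proj₁ (even-index⇒semibad m φ≡mr m-even)
    members : (z : ℕ) → z ∈ coset a ⇔ SemiBad q r z
    members z = mk⇔
      (λ z∈ → proj₁ (proj₂ (proj₂ (coset-coherent a-semibad))) z z∈)
      (λ z-semibad → ∈-coset⁺ a (proj₁ (proj₁ z-semibad))
                       (semibad-same-coset a-semibad (SemiBad⇒SemiBadClass z-semibad)))

  two-primes : 2 ≤ ω q → (∃ λ a → SemiBad q r a) × Σ (List ℕ) λ C → Coherent q r C × length C ≡ r
  two-primes 2≤ω with PrimeFactors.two-prime-factors q 2≤ω
  ... | p₁ , p₂ , p₁≢p₂ , (p₁-prime , p₁∣q) , (p₂-prime , p₂∣q)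
    with coprime-split q≢0 p₁≢p₂ p₁-prime p₁∣q p₂-prime p₂∣q
  ... | A , B , q≡AB , A⊥B , 2≤A , 2≤B with nontrivial-root q-odd q≡AB A⊥B 2≤A 2≤B
  ... | w , w²≈1 , w≉1 , w≉neg1 with semibad-involution 3≤q w²≈1 w≉1 w≉neg1
  ... | a , a-semibad =
    (a % q , semibad-representative a-semibad) , coset a , coset-coherent a-semibad , coset-length a

lemma3 : (q r : ℕ) → 3 ≤ q → q % 2 ≡ 1 → IsOrder2 q r →
  (ω q ≡ 1 → (m : ℕ) → φ q ≡ m * r → m % 2 ≡ 1 →
    (a : ℕ) → ¬ SemiBad q r a)
  × (ω q ≡ 1 → (m : ℕ) → φ q ≡ m * r → m % 2 ≡ 0 →
    Σ (List ℕ) λ E → ((a : ℕ) → (a ∈ E ⇔ SemiBad q r a))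
      × Coherent q r E × length E ≡ r)
  × (2 ≤ ω q →
    (∃ λ a → SemiBad q r a)
      × Σ (List ℕ) λ C → Coherent q r C × length C ≡ r)
lemma3 q r 3≤q q%2≡1 ord = (λ _ → odd-index⇒no-semibad) , prime-power-even , two-primes
  where open Lemma3 q r 3≤q q%2≡1 ord
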